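{- If $M$ is a perfect matching of a nontrivial graph $G$, then $\check s(G)\le \check s(G-M)$.
   Context: All graphs are finite and simple; nontrivial means at least two vertices. $G-M$ is the spanning subgraph of $G$ with edge set $E(G)\setminus M$. A proper edge-coloring assigns colors to edges so that incident edges receive different colors. For a proper edge-coloring $f$, the palette of $v$ is $P_f(v)=\{f(e): e \text{ incident to } v\}$ (possibly empty). The palette index $\check s(G)$ is the minimum over proper edge-colorings of the number of distinct vertex palettes. -}

module Defs where

open import Data.Nat using (ℕ)
open import Data.Bool using (Bool; true; false; _∧_; not)
open import Data.Fin using (Fin)
open import Data.Product using (Σ; ∃; ∃-syntax; _×_; _,_; ∃!)
open import Relation.Binary.PropositionalEquality using (_≡_)
open import Function.Bundles using (_⇔_)
open import Function.Definitions using (Surjective)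

record Graph (n : ℕ) : Set where
  field
    adj    : Fin n → Fin n → Bool
    sym    : ∀ u v → adj u v ≡ adj v u
    irrefl : ∀ v → adj v v ≡ false

open Graph public

Adj : ∀ {n} → Graph n → Fin n → Fin n → Set
Adj G u v = adj G u v ≡ true

record PerfectMatching {n : ℕ} (G : Graph n) : Set where
  field
    inM     : Fin n → Fin n → Bool
    symM    : ∀ u v → inM u v ≡ inM v u
    subset  : ∀ u v → inM u v ≡ true → Adj G u v
    perfect : ∀ v → ∃! _≡_ (λ u → inM v u ≡ true)

open PerfectMatching public

delete : ∀ {n} (G : Graph n) → PerfectMatching G → Graph n
delete {n} G M = record { adj = a ; sym = s ; irrefl = i }
  where
  a : Fin n → Fin n → Bool
  a u v = adj G u v ∧ not (inM M u v)
  s : ∀ u v → a u v ≡ a v u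
  s u v rewrite Graph.sym G u v | symM M u v = Relation.Binary.PropositionalEquality.refl
    where import Relation.Binary.PropositionalEquality
  i : ∀ v → a v v ≡ false
  i v rewrite irrefl G v = Relation.Binary.PropositionalEquality.refl
    where import Relation.Binary.PropositionalEquality

-- An edge-colouring with colours in ℕ: the colour of edge uv is col u v
-- (values on non-edges are irrelevant).
record EdgeColouring {n : ℕ} (G : Graph n) : Set where
  field
    col    : Fin n → Fin n → ℕ
    colSym : ∀ u v → Adj G u v → col u v ≡ col v u
    proper : ∀ v u w → Adj G v u → Adj G v w → col v u ≡ col v w → u ≡ w

open EdgeColouring public

InPalette : ∀ {n} {G : Graph n} → EdgeColouring G → Fin n → ℕ → Set
InPalette {G = G} f v k = ∃[ u ] (Adj G v u × col f v u ≡ k)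

SamePalette : ∀ {n} {G : Graph n} → EdgeColouring G → Fin n → Fin n → Set
SamePalette f v w = ∀ k → InPalette f v k ⇔ InPalette f w k

NumPalettes : ∀ {n} {G : Graph n} → EdgeColouring G → ℕ → Set
NumPalettes {n} f m =
  Σ (Fin n → Fin m) λ π →
    Surjective _≡_ _≡_ π × (∀ v w → (π v ≡ π w) ⇔ SamePalette f v w)

open import Data.Nat using (_≤_)
IsPaletteIndex : ∀ {n} → Graph n → ℕ → Set
IsPaletteIndex G s =
  (∃[ f ] NumPalettes {G = G} f s) ×
  (∀ (f : EdgeColouring G) m → NumPalettes f m → s ≤ m)

-- Colour the edges of M with a fresh colour 0 and shift the colours of G − M
-- up by one. Every vertex meets exactly one edge of M, so the result is proper
-- and the palette of v becomes {0} ∪ (1 + P(v)); two vertices therefore have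
-- equal palettes in G exactly when they do in G − M, and the colouring of G
-- has as many palettes as the one of G − M we started from.
module Submission where

open import Defs
open import Data.Nat using (ℕ; _≤_; zero; suc)
open import Data.Nat.Properties using (suc-injective)
open import Data.Bool using (true; false; if_then_else_)
open import Data.Fin using (Fin)
open import Data.Product using (_×_; _,_)
open import Relation.Binary.PropositionalEquality
  using (_≡_; refl; trans; cong) renaming (sym to ≡-sym)
open import Function.Bundles using (_⇔_; mk⇔)
import Function.Properties.Equivalence as ⇔

module _ {n : ℕ} {G : Graph n} (M : PerfectMatching G) where

  adj-delete⁺ : ∀ {u v} → Adj G u v → inM M u v ≡ false → Adj (delete G M) u v
  adj-delete⁺ uv uv∉M rewrite uv | uv∉M = refl

  adj-delete⁻ : ∀ {u v} → Adj (delete G M) u v → Adj G u v × inM M u v ≡ false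
  adj-delete⁻ {u} {v} uv with adj G u v | inM M u v
  ... | true  | false = refl , refl
  adj-delete⁻ () | true  | true
  adj-delete⁻ () | false | _

  partner-unique : ∀ {v u w} → inM M v u ≡ true → inM M v w ≡ true → u ≡ w
  partner-unique {v} vu vw with perfect M v
  ... | _ , _ , unique = trans (≡-sym (unique vu)) (unique vw)

numPalettes-cong : ∀ {n} {G H : Graph n} (f : EdgeColouring G) (g : EdgeColouring H) →
                   (∀ v w → SamePalette f v w ⇔ SamePalette g v w) →
                   ∀ {m} → NumPalettes f m → NumPalettes g m
numPalettes-cong f g same (π , surjective , classes) =
  π , surjective , λ v w → ⇔.trans (classes v w) (same v w)

module Extension {n : ℕ} {G : Graph n} (M : PerfectMatching G)
                 (f : EdgeColouring (delete G M)) where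

  colour : Fin n → Fin n → ℕ
  colour u v = if inM M u v then 0 else suc (col f u v)

  colour-sym : ∀ u v → Adj G u v → colour u v ≡ colour v u
  colour-sym u v uv rewrite symM M u v with inM M v u in vu
  ... | true  = refl
  ... | false = cong suc (colSym f u v (adj-delete⁺ M uv (trans (symM M u v) vu)))

  colour-proper : ∀ v u w → Adj G v u → Adj G v w → colour v u ≡ colour v w → u ≡ w
  colour-proper v u w vu vw same with inM M v u in mu | inM M v w in mw
  ... | true  | true  = partner-unique M mu mw
  ... | false | false =
    proper f v u w (adj-delete⁺ M vu mu) (adj-delete⁺ M vw mw) (suc-injective same)

  matched : ∀ {u v} → inM M u v ≡ true → colour u v ≡ 0
  matched uv rewrite uv = refl

  shifted : ∀ {u v} → inM M u v ≡ false → colour u v ≡ suc (col f u v)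
  shifted uv rewrite uv = refl

  extension : EdgeColouring G
  extension = record { col = colour ; colSym = colour-sym ; proper = colour-proper }

  zero∈palette : ∀ v → InPalette extension v 0
  zero∈palette v with perfect M v
  ... | u , vu , _ = u , subset M v u vu , matched vu

  suc∈palette⇔ : ∀ v k → InPalette extension v (suc k) ⇔ InPalette f v k
  suc∈palette⇔ v k = mk⇔ to from
    where
    unmatched : ∀ {u} → Adj G v u → colour v u ≡ suc k → InPalette f v k
    unmatched {u} vu coloured with inM M v u in mu
    ... | false = u , adj-delete⁺ M vu mu , suc-injective coloured

    to : InPalette extension v (suc k) → InPalette f v k
    to (u , vu , coloured) = unmatched vu coloured

    from : InPalette f v k → InPalette extension v (suc k)
    from (u , vu , coloured) with adj-delete⁻ M vu
    ... | vu′ , mu = u , vu′ , trans (shifted mu) (cong suc coloured)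

  samePalette⇔ : ∀ v w → SamePalette extension v w ⇔ SamePalette f v w
  samePalette⇔ v w = mk⇔ restrict extend
    where
    restrict : SamePalette extension v w → SamePalette f v w
    restrict same k =
      ⇔.trans (⇔.sym (suc∈palette⇔ v k)) (⇔.trans (same (suc k)) (suc∈palette⇔ w k))

    extend : SamePalette f v w → SamePalette extension v w
    extend same zero    = mk⇔ (λ _ → zero∈palette w) (λ _ → zero∈palette v)
    extend same (suc k) =
      ⇔.trans (suc∈palette⇔ v k) (⇔.trans (same k) (⇔.sym (suc∈palette⇔ w k)))

-- The argument does not use the hypothesis 2 ≤ n.
proposition1 : ∀ (n : ℕ) → 2 ≤ n → (G : Graph n) (M : PerfectMatching G)
    (s s′ : ℕ) → IsPaletteIndex G s → IsPaletteIndex (delete G M) s′ → s ≤ s′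
proposition1 n _ G M s s′ (_ , s-minimal) ((f , s′-palettes) , _) =
  s-minimal extension s′
    (numPalettes-cong f extension (λ v w → ⇔.sym (samePalette⇔ v w)) s′-palettes)
  where open Extension M f
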